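{- Let $p$ be a prime, $n\ge1$, $f\in\mathbb{Z}[x]$, and let $C$ be a cycle of size $k$ in $G(f,\mathbb{Z}_{p^n})$ with $\bar\lambda(C)=1$. Let $v$ be a vertex of $C$. (1) For any integer representative $a$ of $v$, $f^k(a)\equiv a+r_vp^n \pmod{p^{n+1}}$; i.e., any representative of $v$ may be used in place of $a_v$ in the definition of $r_v$. (2) Either $r_w=0$ for all vertices $w$ of $C$, or $r_w\ne0$ for all vertices $w$ of $C$. (3) Assume $p>3$, or $p=3$ and $n>1$. Let $v'$ be a vertex of a lifted cycle $C'$ of $C$ in $G(f,\mathbb{Z}_{p^{n+1}})$ such that $\pi_{n+1,n}(v')=v$, where $\pi_{n+1,n}:\mathbb{Z}_{p^{n+1}}\to\mathbb{Z}_{p^n}$ is the projection. If $r_v\ne0$, then $r_{v'}\ne0$ (where $r_{v'}$ is taken with respect to the cycle $C'$ in $G(f,\mathbb{Z}_{p^{n+1}})$).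
   Context: $\mathbb{Z}_N:=\mathbb{Z}/N\mathbb{Z}$; $f^i$ is the $i$-th iterate; $G(f,\mathbb{Z}_N)$ is the directed graph on $\mathbb{Z}_N$ with edges $(v,f(v))$. A cycle of size $k$ is a set of $k$ distinct vertices $v_0,\dots,v_{k-1}$ with $f(v_i)=v_{i+1}$ (indices mod $k$). The lifted graph of $C$ in $G(f,\mathbb{Z}_{p^{n+1}})$ is the subgraph induced on $\pi_{n+1,n}^{ -1}(C)$; a lifted cycle is a cycle in it. Multiplier: $\lambda(C)=(f^k)'(v_0)=\prod_{w\in C}f'(w)$, with $\bar\lambda(C)$ its image in $\mathbb{Z}_p$. For a vertex $v$ of a cycle $C$ of size $k$ in $G(f,\mathbb{Z}_{p^n})$, with $a_v\in[0,p^n)$ the unique representative of $v$, $r_v\in[0,p)$ is the remainder of the integer $(f^k(a_v)-a_v)/p^n$ upon division by $p$ (so $f^k(a_v)\equiv a_v+r_vp^n\pmod{p^{n+1}}$); for a vertex of a cycle in $G(f,\mathbb{Z}_{p^{n+1}})$ the same definition is used with $n+1$ in place of $n$ and the size of that cycle in place of $k$. -}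

module Defs where

open import Data.Nat as ℕ using (ℕ; zero; suc; NonZero)
open import Data.Nat.Properties using (m^n≢0)
open import Data.Nat.Primality using (Prime; prime⇒nonZero)
open import Data.Integer using (ℤ; +_; _+_; _-_; _*_; _/ℕ_; _%ℕ_)
open import Data.Integer.Divisibility using (_∣_)
open import Data.List using (List; []; _∷_)
open import Data.Product using (_×_)
open import Relation.Binary.PropositionalEquality using (_≡_)

-- Polynomials in ℤ[x] as coefficient lists, lowest degree first.
Poly : Set
Poly = List ℤ

eval : Poly → ℤ → ℤ
eval []       x = + 0
eval (c ∷ cs) x = c + x * eval cs x

derivAux : ℕ → Poly → Poly
derivAux i []       = []
derivAux i (c ∷ cs) = (+ i) * c ∷ derivAux (suc i) cs

deriv : Poly → Poly
deriv []       = []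
deriv (_ ∷ cs) = derivAux 1 cs

iter : Poly → ℕ → ℤ → ℤ
iter f zero    x = x
iter f (suc i) x = eval f (iter f i x)

_≡_[mod_] : ℤ → ℤ → ℕ → Set
a ≡ b [mod N ] = (+ N) ∣ (a - b)

prodUpTo : ℕ → (ℕ → ℤ) → ℤ
prodUpTo zero    g = + 1
prodUpTo (suc k) g = prodUpTo k g * g k

-- A cycle of size k in G(f, ℤ_N), given by integer representatives c 0, c 1, ...
-- of its vertices v_0, ..., v_{k-1} (v_i = c i mod N; the sequence is continued
-- beyond k by f, so c k ≡ c 0): k ≥ 1, f(v_i) = v_{i+1}, v_k = v_0, and
-- v_0, ..., v_{k-1} pairwise distinct in ℤ_N.
IsCycle : ℕ → Poly → ℕ → (ℕ → ℤ) → Set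
IsCycle N f k c =
  (1 ℕ.≤ k)
  × (∀ i → eval f (c i) ≡ c (suc i) [mod N ])
  × (c k ≡ c 0 [mod N ])
  × (∀ i j → i ℕ.< k → j ℕ.< k → c i ≡ c j [mod N ] → i ≡ j)

multiplier : Poly → ℕ → (ℕ → ℤ) → ℤ
multiplier f k c = prodUpTo k (λ i → eval (deriv f) (c i))

-- r_v for the vertex v of a cycle of size k in G(f, ℤ_{p^n}), given any integer
-- representative a of v: a_v = a mod p^n ∈ [0, p^n), and r_v is the remainder
-- of (f^k(a_v) - a_v)/p^n upon division by p.
rv : (p : ℕ) → Prime p → (n : ℕ) → Poly → (k : ℕ) → ℤ → ℕ
rv p pr n f k a =
  let instance _ = prime⇒nonZero pr
      instance _ = m^n≢0 p n
      av = + (a %ℕ (p ℕ.^ n))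
  in ((iter f k av - av) /ℕ (p ℕ.^ n)) %ℕ p

-- Write g = f^k and, for a vertex x of C, D(x) = g(x) - x, a multiple of p^n. The derivative
-- g'(x) is, modulo p^n, a cyclic rotation of the product defining λ(C), hence ≡ 1 mod p. The
-- second-order Taylor expansion of g then shows that D(x) mod p^(n+1) depends only on x mod p^n
-- (part 1), and that D(f x) ≡ f'(x) D(x) mod p^(n+1) with f'(x) a unit mod p (part 2).
-- Iterating the expansion gives g^p(x) ≡ x + p D(x) mod p^(n+2) as soon as p divides
-- Σ_{j<p} j and p^(n+2) divides p^(2n) Σ_{j<p} j², which is what p > 3, or p = 3 and n > 1,
-- guarantees. Hence the size k' of C' satisfies k ∣ k' ∣ p k: k' = k would force r_v = 0, and
-- for k' = p k the digit r_v' equals r_v.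
module Submission where

open import Defs
open import Data.Nat using (ℕ; suc; _^_; _≤_; _<_; _>_)
open import Data.Nat.Primality using (Prime)
open import Data.Integer using (ℤ; +_; _+_; _*_)
open import Data.Product using (_×_; Σ; ∃)
open import Data.Sum using (_⊎_)
open import Relation.Binary.PropositionalEquality using (_≡_; _≢_)

open import Data.Nat as ℕ using (zero; NonZero; _≟_)
import Data.Nat.Properties as ℕ
open import Data.Nat.DivMod using (_%_; _/_; m≡m%n+[m/n]*n; m%n<n)
open import Data.Nat.Divisibility as ℕ using (>⇒∤; m%n≡0⇒n∣m) renaming (_∣_ to _∣ℕ_)
open import Data.Nat.GeneralisedArithmetic using (fold)
open import Data.Nat.Primality using (prime⇒nonZero; ¬prime[1]; euclidsLemma; prime⇒irreducible)
import Data.Nat.Tactic.RingSolver as ℕ-Solver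
open import Data.Integer using (_-_; -_; ∣_∣; _/ℕ_; _%ℕ_)
import Data.Integer.Properties as ℤ
open import Data.Integer.DivMod using (a≡a%ℕn+[a/ℕn]*n; n%ℕd<d)
open import Data.Integer.Divisibility.Signed
open import Data.Integer.Tactic.RingSolver using (solve-∀)
open import Data.Empty using (⊥)
open import Data.List using ([]; _∷_)
open import Data.Product using (_,_; proj₁; proj₂)
open import Data.Sum using (inj₁; inj₂)
import Data.Sum as Sum
open import Function using (_∘_)
open import Relation.Binary.Bundles using (Setoid)
open import Relation.Binary.PropositionalEquality using (refl; sym; trans; cong; subst; subst₂)
import Relation.Binary.PropositionalEquality as ≡
import Relation.Binary.Reasoning.Setoid as SetoidReasoning
open import Relation.Nullary using (contradiction; yes; no)

-- Congruences

-- The relation _≡_[mod_] of Defs unfolds to divisibility of absolute values, which hides a and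
-- b from unification; this record keeps them visible.
infix 4 _≡_⟨mod_⟩
record _≡_⟨mod_⟩ (a b : ℤ) (m : ℕ) : Set where
  constructor mod-divides
  field
    divides-difference : + m ∣ a - b
open _≡_⟨mod_⟩

[mod]⇒⟨mod⟩ : ∀ {m a b} → a ≡ b [mod m ] → a ≡ b ⟨mod m ⟩
[mod]⇒⟨mod⟩ m∣a-b = mod-divides (∣ᵤ⇒∣ m∣a-b)

⟨mod⟩⇒[mod] : ∀ {m a b} → a ≡ b ⟨mod m ⟩ → a ≡ b [mod m ]
⟨mod⟩⇒[mod] (mod-divides m∣a-b) = ∣⇒∣ᵤ m∣a-b

≡⇒≡-mod : ∀ {m a b} → a ≡ b → a ≡ b ⟨mod m ⟩
≡⇒≡-mod {a = a} refl = mod-divides (divides (+ 0) (ℤ.+-inverseʳ a))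

≡-mod-refl : ∀ {m a} → a ≡ a ⟨mod m ⟩
≡-mod-refl = ≡⇒≡-mod refl

≡-mod-sym : ∀ {m a b} → a ≡ b ⟨mod m ⟩ → b ≡ a ⟨mod m ⟩
≡-mod-sym {a = a} {b} (mod-divides m∣a-b) = mod-divides (subst (_ ∣_) (swap a b) (∣m⇒∣-m m∣a-b))
  where
  swap : ∀ a b → - (a - b) ≡ b - a
  swap = solve-∀

≡-mod-trans : ∀ {m a b c} → a ≡ b ⟨mod m ⟩ → b ≡ c ⟨mod m ⟩ → a ≡ c ⟨mod m ⟩
≡-mod-trans {a = a} {b} {c} (mod-divides m∣a-b) (mod-divides m∣b-c) =
  mod-divides (subst (_ ∣_) (telescope a b c) (∣m∣n⇒∣m+n m∣a-b m∣b-c))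
  where
  telescope : ∀ a b c → (a - b) + (b - c) ≡ a - c
  telescope = solve-∀

≡-mod-setoid : ℕ → Setoid _ _
≡-mod-setoid m = record
  { Carrier       = ℤ
  ; _≈_           = _≡_⟨mod m ⟩
  ; isEquivalence = record { refl = ≡-mod-refl ; sym = ≡-mod-sym ; trans = ≡-mod-trans }
  }

module ≡-mod-Reasoning (m : ℕ) = SetoidReasoning (≡-mod-setoid m)

+-cong-mod : ∀ {m a b c d} → a ≡ b ⟨mod m ⟩ → c ≡ d ⟨mod m ⟩ → a + c ≡ b + d ⟨mod m ⟩
+-cong-mod {a = a} {b} {c} {d} (mod-divides m∣a-b) (mod-divides m∣c-d) =
  mod-divides (subst (_ ∣_) (regroup a b c d) (∣m∣n⇒∣m+n m∣a-b m∣c-d))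
  where
  regroup : ∀ a b c d → (a - b) + (c - d) ≡ (a + c) - (b + d)
  regroup = solve-∀

*-cong-mod : ∀ {m a b c d} → a ≡ b ⟨mod m ⟩ → c ≡ d ⟨mod m ⟩ → a * c ≡ b * d ⟨mod m ⟩
*-cong-mod {a = a} {b} {c} {d} (mod-divides m∣a-b) (mod-divides m∣c-d) =
  mod-divides (subst (_ ∣_) (regroup a b c d) (∣m∣n⇒∣m+n (∣n⇒∣m*n a m∣c-d) (∣m⇒∣m*n d m∣a-b)))
  where
  regroup : ∀ a b c d → a * (c - d) + (a - b) * d ≡ a * c - b * d
  regroup = solve-∀

+-congˡ-mod : ∀ {m a b} c → a ≡ b ⟨mod m ⟩ → c + a ≡ c + b ⟨mod m ⟩
+-congˡ-mod c = +-cong-mod (≡-mod-refl {a = c})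

+-congʳ-mod : ∀ {m a b} c → a ≡ b ⟨mod m ⟩ → a + c ≡ b + c ⟨mod m ⟩
+-congʳ-mod c a≡b = +-cong-mod a≡b (≡-mod-refl {a = c})

*-congˡ-mod : ∀ {m a b} c → a ≡ b ⟨mod m ⟩ → c * a ≡ c * b ⟨mod m ⟩
*-congˡ-mod c = *-cong-mod (≡-mod-refl {a = c})

≡-mod-weaken : ∀ {m n a b} → n ∣ℕ m → a ≡ b ⟨mod m ⟩ → a ≡ b ⟨mod n ⟩
≡-mod-weaken n∣m (mod-divides m∣a-b) = mod-divides (∣-trans (∣ᵤ⇒∣ n∣m) m∣a-b)

+-multiple-≡-mod : ∀ {m a h} → + m ∣ h → a + h ≡ a ⟨mod m ⟩
+-multiple-≡-mod {a = a} {h} m∣h = mod-divides (subst (_ ∣_) (cancel a h) m∣h)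
  where
  cancel : ∀ a h → h ≡ a + h - a
  cancel = solve-∀

-≡⇒≡+-mod : ∀ {m a b c} → a - b ≡ c ⟨mod m ⟩ → a ≡ b + c ⟨mod m ⟩
-≡⇒≡+-mod {m} {a} {b} {c} a-b≡c = begin
  a            ≡⟨ sym (b+[a-b]≡a a b) ⟩
  b + (a - b)  ≈⟨ +-congˡ-mod b a-b≡c ⟩
  b + c        ∎
  where
  open ≡-mod-Reasoning m
  b+[a-b]≡a : ∀ a b → b + (a - b) ≡ a
  b+[a-b]≡a = solve-∀

≡+⇒-≡-mod : ∀ {m a b c} → a ≡ b + c ⟨mod m ⟩ → a - b ≡ c ⟨mod m ⟩
≡+⇒-≡-mod {m} {a} {b} {c} a≡b+c = begin
  a - b        ≈⟨ +-congʳ-mod (- b) a≡b+c ⟩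
  b + c - b    ≡⟨ b+c-b≡c b c ⟩
  c            ∎
  where
  open ≡-mod-Reasoning m
  b+c-b≡c : ∀ b c → b + c - b ≡ c
  b+c-b≡c = solve-∀

*-pres-∣ : ∀ {m n a b} → + m ∣ a → + n ∣ b → + (m ℕ.* n) ∣ a * b
*-pres-∣ {m} {n} (divides q refl) (divides r refl) =
  divides (q * r) (trans (regroup q (+ m) r (+ n)) (cong (q * r *_) (sym (ℤ.pos-* m n))))
  where
  regroup : ∀ q m r n → q * m * (r * n) ≡ q * r * (m * n)
  regroup = solve-∀

∣-square : ∀ {p N h} → p ∣ℕ N → + N ∣ h → + (p ℕ.* N) ∣ h * h
∣-square {N = N} p∣N N∣h = ∣-trans (∣ᵤ⇒∣ (ℕ.*-monoˡ-∣ N p∣N)) (*-pres-∣ N∣h N∣h)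

*-scaleˡ-mod : ∀ {m a b} n → a ≡ b ⟨mod m ⟩ → + n * a ≡ + n * b ⟨mod n ℕ.* m ⟩
*-scaleˡ-mod {a = a} {b} n (mod-divides m∣a-b) =
  mod-divides (subst (_ ∣_) (distrib (+ n) a b) (*-pres-∣ (∣-refl {+ n}) m∣a-b))
  where
  distrib : ∀ n a b → n * (a - b) ≡ n * a - n * b
  distrib = solve-∀

*-cong-∣-mod : ∀ {m n a b h} → a ≡ b ⟨mod m ⟩ → + n ∣ h → a * h ≡ b * h ⟨mod m ℕ.* n ⟩
*-cong-∣-mod {a = a} {b} {h} (mod-divides m∣a-b) n∣h =
  mod-divides (subst (_ ∣_) (distrib a b h) (*-pres-∣ m∣a-b n∣h))
  where
  distrib : ∀ a b h → (a - b) * h ≡ a * h - b * h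
  distrib = solve-∀

*-cancelʳ-mod : ∀ {m a b} n .{{_ : NonZero n}} → a * + n ≡ b * + n ⟨mod m ℕ.* n ⟩ → a ≡ b ⟨mod m ⟩
*-cancelʳ-mod {m} {a} {b} n (mod-divides mn∣an-bn) =
  mod-divides (*-cancelʳ-∣ (+ n) (subst₂ _∣_ (ℤ.pos-* m n) (distrib a b (+ n)) mn∣an-bn))
  where
  distrib : ∀ a b n → a * n - b * n ≡ (a - b) * n
  distrib = solve-∀

-- Integer arithmetic

∣-<⇒≡0 : ∀ {n r} → n ∣ℕ r → r < n → r ≡ 0
∣-<⇒≡0 {r = zero}  _   _   = refl
∣-<⇒≡0 {r = suc r} n∣r r<n = contradiction n∣r (>⇒∤ r<n)

≡0-mod⇒≡0 : ∀ {n r} → + r ≡ + 0 ⟨mod n ⟩ → r < n → r ≡ 0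
≡0-mod⇒≡0 {n} {r} (mod-divides n∣r-0) = ∣-<⇒≡0 (∣⇒∣ᵤ (subst (+ n ∣_) (ℤ.+-identityʳ (+ r)) n∣r-0))

%ℕ-≡-mod : ∀ a n .{{_ : NonZero n}} → + (a %ℕ n) ≡ a ⟨mod n ⟩
%ℕ-≡-mod a n = ≡-mod-sym (≡-mod-trans (≡⇒≡-mod (a≡a%ℕn+[a/ℕn]*n a n))
                                      (+-multiple-≡-mod (divides (a /ℕ n) refl)))

∣⇒≡-digit : ∀ {x} N p .{{_ : NonZero N}} .{{_ : NonZero p}} → + N ∣ x →
            x ≡ + ((x /ℕ N) %ℕ p) * + N ⟨mod p ℕ.* N ⟩
∣⇒≡-digit {x} N p N∣x = begin
  x                                         ≡⟨ a≡a%ℕn+[a/ℕn]*n x N ⟩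
  + (x %ℕ N) + q * + N                      ≡⟨ cong (λ r → + r + q * + N) x%N≡0 ⟩
  + 0 + q * + N                             ≡⟨ ℤ.+-identityˡ (q * + N) ⟩
  q * + N                                   ≡⟨ cong (_* + N) (a≡a%ℕn+[a/ℕn]*n q p) ⟩
  (+ (q %ℕ p) + (q /ℕ p) * + p) * + N       ≡⟨ distrib (+ (q %ℕ p)) (q /ℕ p) (+ p) (+ N) ⟩
  + (q %ℕ p) * + N + (q /ℕ p) * (+ p * + N) ≈⟨ +-multiple-≡-mod p*N∣ ⟩
  + (q %ℕ p) * + N                          ∎
  where
  open ≡-mod-Reasoning (p ℕ.* N)
  q = x /ℕ N
  p*N∣ : + (p ℕ.* N) ∣ (q /ℕ p) * (+ p * + N)
  p*N∣ = divides (q /ℕ p) (cong ((q /ℕ p) *_) (sym (ℤ.pos-* p N)))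
  x-qN≡x%N : x - q * + N ≡ + (x %ℕ N)
  x-qN≡x%N = subst (λ y → y - q * + N ≡ + (x %ℕ N)) (sym (a≡a%ℕn+[a/ℕn]*n x N)) (cancel (+ (x %ℕ N)) (q * + N))
    where
    cancel : ∀ r s → r + s - s ≡ r
    cancel = solve-∀
  x%N≡0 : x %ℕ N ≡ 0
  x%N≡0 = ∣-<⇒≡0 (∣⇒∣ᵤ (subst (+ N ∣_) x-qN≡x%N (∣m∣n⇒∣m-n N∣x (∣n⇒∣m*n q ∣-refl))))
                  (n%ℕd<d x N)
  distrib : ∀ r s p N → (r + s * p) * N ≡ r * N + s * (p * N)
  distrib = solve-∀

prime-∣-* : ∀ {p a b} → Prime p → + p ∣ a * b → (+ p ∣ a) ⊎ (+ p ∣ b)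
prime-∣-* {a = a} {b} pr p∣ab
  with euclidsLemma ∣ a ∣ ∣ b ∣ pr (subst (_ ∣ℕ_) (ℤ.abs-* a b) (∣⇒∣ᵤ p∣ab))
... | inj₁ p∣a = inj₁ (∣ᵤ⇒∣ p∣a)
... | inj₂ p∣b = inj₂ (∣ᵤ⇒∣ p∣b)

prime-∤-unit : ∀ {p a} → Prime p → a ≡ + 1 ⟨mod p ⟩ → + p ∣ a → ⊥
prime-∤-unit {p} {a} pr (mod-divides p∣a-1) p∣a =
  ¬prime[1] (subst Prime (ℕ.∣1⇒≡1 (∣⇒∣ᵤ p∣1)) pr)
  where
  a-[a-1]≡1 : ∀ a → a - (a - + 1) ≡ + 1
  a-[a-1]≡1 = solve-∀
  p∣1 : + p ∣ + 1
  p∣1 = subst (+ p ∣_) (a-[a-1]≡1 a) (∣m∣n⇒∣m-n p∣a p∣a-1)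

k∣m∣p*k⇒m≡k⊎m≡p*k : ∀ {p k m} → Prime p → .{{_ : NonZero k}} → k ∣ℕ m → m ∣ℕ p ℕ.* k →
                     m ≡ k ⊎ m ≡ p ℕ.* k
k∣m∣p*k⇒m≡k⊎m≡p*k {p} {k} pr (ℕ.divides q refl) (ℕ.divides t pk≡tqk)
  with prime⇒irreducible pr (ℕ.divides t p≡tq)
  where
  p≡tq : p ≡ t ℕ.* q
  p≡tq = ℕ.*-cancelʳ-≡ p (t ℕ.* q) k (trans pk≡tqk (sym (ℕ.*-assoc t q k)))
... | inj₁ refl = inj₁ (ℕ.*-identityˡ k)
... | inj₂ refl = inj₂ refl

-- Polynomials and their iterates

eval-cong : ∀ f {m a b} → a ≡ b ⟨mod m ⟩ → eval f a ≡ eval f b ⟨mod m ⟩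
eval-cong []       a≡b = ≡-mod-refl
eval-cong (c ∷ cs) a≡b = +-congˡ-mod c (*-cong-mod a≡b (eval-cong cs a≡b))

iter-cong : ∀ f k {m a b} → a ≡ b ⟨mod m ⟩ → iter f k a ≡ iter f k b ⟨mod m ⟩
iter-cong f zero    a≡b = a≡b
iter-cong f (suc k) a≡b = eval-cong f (iter-cong f k a≡b)

iter-+ : ∀ f i j x → iter f (i ℕ.+ j) x ≡ iter f i (iter f j x)
iter-+ f zero    j x = refl
iter-+ f (suc i) j x = cong (eval f) (iter-+ f i j x)

iter-*-fold : ∀ f k t x → iter f (t ℕ.* k) x ≡ fold x (iter f k) t
iter-*-fold f k zero    x = refl
iter-*-fold f k (suc t) x = trans (iter-+ f k (t ℕ.* k) x) (cong (iter f k) (iter-*-fold f k t x))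

iter-eval-comm : ∀ f k x → iter f k (eval f x) ≡ eval f (iter f k x)
iter-eval-comm f k x =
  trans (sym (iter-+ f k 1 x)) (trans (cong (λ t → iter f t x) (ℕ.+-comm k 1)) (iter-+ f 1 k x))

eval-derivAux-suc : ∀ i cs y → eval (derivAux (suc i) cs) y ≡ eval (derivAux i cs) y + eval cs y
eval-derivAux-suc i []       y = refl
eval-derivAux-suc i (c ∷ cs) y =
  trans (cong (λ e → + suc i * c + y * e) (eval-derivAux-suc (suc i) cs y)) (regroup (+ i) c y _ _)
  where
  regroup : ∀ i c y e e′ → (+ 1 + i) * c + y * (e + e′) ≡ (i * c + y * e) + (c + y * e′)
  regroup = solve-∀

eval-derivAux-zero : ∀ cs y → eval (derivAux 0 cs) y ≡ y * eval (deriv cs) y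
eval-derivAux-zero []       y = sym (ℤ.*-zeroʳ y)
eval-derivAux-zero (c ∷ cs) y = ℤ.+-identityˡ _

eval-deriv-∷ : ∀ c cs y → eval (deriv (c ∷ cs)) y ≡ eval cs y + y * eval (deriv cs) y
eval-deriv-∷ c cs y = begin
  eval (derivAux 1 cs) y              ≡⟨ eval-derivAux-suc 0 cs y ⟩
  eval (derivAux 0 cs) y + eval cs y  ≡⟨ cong (_+ eval cs y) (eval-derivAux-zero cs y) ⟩
  y * eval (deriv cs) y + eval cs y   ≡⟨ ℤ.+-comm _ (eval cs y) ⟩
  eval cs y + y * eval (deriv cs) y   ∎
  where open ≡.≡-Reasoning

record QuadraticExpansion (g : ℤ → ℤ) (y slope : ℤ) : Set where
  field
    quadratic : ℤ
    cubic     : ℤ → ℤ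
    expand    : ∀ h → g (y + h) ≡ g y + slope * h + quadratic * (h * h) + cubic h * (h * h * h)

slope-≡ : ∀ {g y d d′} → d ≡ d′ → QuadraticExpansion g y d → QuadraticExpansion g y d′
slope-≡ refl E = E

eval-expansion : ∀ f y → QuadraticExpansion (eval f) y (eval (deriv f) y)
eval-expansion []       y = record { quadratic = + 0 ; cubic = λ _ → + 0 ; expand = vanish }
  where
  vanish : ∀ h → + 0 ≡ + 0 + + 0 * h + + 0 * (h * h) + + 0 * (h * h * h)
  vanish = solve-∀
eval-expansion (c ∷ cs) y = slope-≡ (sym (eval-deriv-∷ c cs y)) (record
  { quadratic = eval (deriv cs) y + y * Q
  ; cubic     = λ h → Q + y * R h + h * R h
  ; expand    = λ h → trans (cong (λ v → c + (y + h) * v) (expand h))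
                            (multiply c y h (eval cs y) (eval (deriv cs) y) Q (R h))
  })
  where
  open QuadraticExpansion (eval-expansion cs y) renaming (quadratic to Q; cubic to R)
  multiply : ∀ c y h e e′ Q R →
    c + (y + h) * (e + e′ * h + Q * (h * h) + R * (h * h * h))
      ≡ c + y * e + (e + y * e′) * h + (e′ + y * Q) * (h * h) + (Q + y * R + h * R) * (h * h * h)
  multiply = solve-∀

∘-expansion : ∀ {f g : ℤ → ℤ} {y a b} → QuadraticExpansion g y a → QuadraticExpansion f (g y) b →
              QuadraticExpansion (f ∘ g) y (a * b)
∘-expansion {f} {g} {y} {a} {b} Eg Ef = record
  { quadratic = b * Q + Q′ * (a * a)
  ; cubic     = λ h → let u = Q + R h * h in
                  b * R h + Q′ * (+ 2 * a * u + h * (u * u)) + R′ (step h) * ((a + h * u) * (a + h * u) * (a + h * u))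
  ; expand    = λ h → begin
      f (g (y + h))     ≡⟨ cong f (trans (expand h) (regroup (g y) a Q (R h) h)) ⟩
      f (g y + step h)  ≡⟨ expand′ (step h) ⟩
      f (g y) + b * step h + Q′ * (step h * step h) + R′ (step h) * (step h * step h * step h)
                        ≡⟨ compose (f (g y)) a b Q (R h) Q′ (R′ (step h)) h ⟩
      _                 ∎
  }
  where
  open QuadraticExpansion Eg using (expand) renaming (quadratic to Q; cubic to R)
  open QuadraticExpansion Ef using () renaming (quadratic to Q′; cubic to R′; expand to expand′)
  open ≡.≡-Reasoning
  step : ℤ → ℤ
  step h = a * h + Q * (h * h) + R h * (h * h * h)
  regroup : ∀ z a Q R h → z + a * h + Q * (h * h) + R * (h * h * h) ≡ z + (a * h + Q * (h * h) + R * (h * h * h))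
  regroup = solve-∀
  compose : ∀ z a b Q R Q′ R′ h →
    let k = a * h + Q * (h * h) + R * (h * h * h)
        u = Q + R * h
    in z + b * k + Q′ * (k * k) + R′ * (k * k * k)
       ≡ z + a * b * h + (b * Q + Q′ * (a * a)) * (h * h)
           + (b * R + Q′ * (+ 2 * a * u + h * (u * u)) + R′ * ((a + h * u) * (a + h * u) * (a + h * u))) * (h * h * h)
  compose = solve-∀

iterDeriv : Poly → ℕ → ℤ → ℤ
iterDeriv f k y = prodUpTo k (λ j → eval (deriv f) (iter f j y))

iter-expansion : ∀ f k y → QuadraticExpansion (iter f k) y (iterDeriv f k y)
iter-expansion f zero    y = record { quadratic = + 0 ; cubic = λ _ → + 0 ; expand = identity y }
  where
  identity : ∀ y h → y + h ≡ y + + 1 * h + + 0 * (h * h) + + 0 * (h * h * h)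
  identity = solve-∀
iter-expansion f (suc k) y = ∘-expansion (iter-expansion f k y) (eval-expansion f (iter f k y))

linearise : ∀ {g y d h m} → QuadraticExpansion g y d → + m ∣ h * h → g (y + h) ≡ g y + d * h ⟨mod m ⟩
linearise {g} {y} {d} {h} E m∣h² = begin
  g (y + h)                                           ≡⟨ trans (expand h) (factor (g y) d quadratic (cubic h) h) ⟩
  (g y + d * h) + (quadratic + cubic h * h) * (h * h)
    ≈⟨ +-multiple-≡-mod (∣n⇒∣m*n (quadratic + cubic h * h) m∣h²) ⟩
  g y + d * h                                         ∎
  where
  open QuadraticExpansion E
  open ≡-mod-Reasoning _
  factor : ∀ z d Q R h → z + d * h + Q * (h * h) + R * (h * h * h) ≡ (z + d * h) + (Q + R * h) * (h * h)
  factor = solve-∀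

displacement-≡ : ∀ {g y d x p N} → QuadraticExpansion g y d → d ≡ + 1 ⟨mod p ⟩ → p ∣ℕ N →
                 x ≡ y ⟨mod N ⟩ → g x - x ≡ g y - y ⟨mod p ℕ.* N ⟩
displacement-≡ {g} {y} {d} {x} {p} {N} E d≡1 p∣N x≡y = begin
  g x - x                ≡⟨ cong (λ z → g z - z) (sym (y+[x-y]≡x x y)) ⟩
  g (y + h) - (y + h)    ≈⟨ +-congʳ-mod (- (y + h)) (linearise E (∣-square p∣N N∣h)) ⟩
  g y + d * h - (y + h)  ≈⟨ +-congʳ-mod (- (y + h)) (+-congˡ-mod (g y) dh≡h) ⟩
  g y + h - (y + h)      ≡⟨ cancel (g y) y h ⟩
  g y - y                ∎
  where
  open ≡-mod-Reasoning (p ℕ.* N)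
  h = x - y
  N∣h = divides-difference x≡y
  dh≡h : d * h ≡ h ⟨mod p ℕ.* N ⟩
  dh≡h = ≡-mod-trans (*-cong-∣-mod d≡1 N∣h) (≡⇒≡-mod (ℤ.*-identityˡ h))
  y+[x-y]≡x : ∀ x y → y + (x - y) ≡ x
  y+[x-y]≡x = solve-∀
  cancel : ∀ a y h → a + h - (y + h) ≡ a - y
  cancel = solve-∀

-- Products and cycles

prodUpTo-cong : ∀ k {g h m} → (∀ j → j < k → g j ≡ h j ⟨mod m ⟩) → prodUpTo k g ≡ prodUpTo k h ⟨mod m ⟩
prodUpTo-cong zero    g≡h = ≡-mod-refl
prodUpTo-cong (suc k) g≡h = *-cong-mod (prodUpTo-cong k (λ j j<k → g≡h j (ℕ.m<n⇒m<1+n j<k))) (g≡h k ℕ.≤-refl)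

prodUpTo-suc : ∀ k g → prodUpTo (suc k) g ≡ g 0 * prodUpTo k (g ∘ suc)
prodUpTo-suc zero    g = ℤ.*-comm (+ 1) (g 0)
prodUpTo-suc (suc k) g = trans (cong (_* g (suc k)) (prodUpTo-suc k g))
                               (ℤ.*-assoc (g 0) (prodUpTo k (g ∘ suc)) (g (suc k)))

prodUpTo-rotate : ∀ k {g m} → g k ≡ g 0 ⟨mod m ⟩ → prodUpTo k (g ∘ suc) ≡ prodUpTo k g ⟨mod m ⟩
prodUpTo-rotate zero            gk≡g0 = ≡-mod-refl
prodUpTo-rotate (suc k) {g} {m} gk≡g0 = begin
  prodUpTo k (g ∘ suc) * g (suc k)  ≈⟨ *-congˡ-mod (prodUpTo k (g ∘ suc)) gk≡g0 ⟩
  prodUpTo k (g ∘ suc) * g 0        ≡⟨ ℤ.*-comm (prodUpTo k (g ∘ suc)) (g 0) ⟩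
  g 0 * prodUpTo k (g ∘ suc)        ≡⟨ sym (prodUpTo-suc k g) ⟩
  prodUpTo (suc k) g                ∎
  where open ≡-mod-Reasoning m

∣-prodUpTo : ∀ {d g j} k → j < k → d ∣ g j → d ∣ prodUpTo k g
∣-prodUpTo {g = g} (suc k) j<1+k d∣gj with ℕ.m<1+n⇒m<n∨m≡n j<1+k
... | inj₁ j<k  = ∣m⇒∣m*n (g k) (∣-prodUpTo k j<k d∣gj)
... | inj₂ refl = ∣n⇒∣m*n (prodUpTo k g) d∣gj

module Cycle {m k : ℕ} (f : Poly) (c : ℕ → ℤ) (cycle : IsCycle m f k c) where

  private
    step : ∀ i → eval f (c i) ≡ c (suc i) ⟨mod m ⟩
    step i = [mod]⇒⟨mod⟩ (proj₁ (proj₂ cycle) i)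

    closes : c k ≡ c 0 ⟨mod m ⟩
    closes = [mod]⇒⟨mod⟩ (proj₁ (proj₂ (proj₂ cycle)))

    distinct : ∀ {i j} → i < k → j < k → c i ≡ c j ⟨mod m ⟩ → i ≡ j
    distinct i<k j<k ci≡cj = proj₂ (proj₂ (proj₂ cycle)) _ _ i<k j<k (⟨mod⟩⇒[mod] ci≡cj)

    c-≡ : ∀ {i j} → i ≡ j → c i ≡ c j ⟨mod m ⟩
    c-≡ = ≡⇒≡-mod ∘ cong c

  open ≡-mod-Reasoning m

  orbit : ∀ j i → iter f j (c i) ≡ c (j ℕ.+ i) ⟨mod m ⟩
  orbit zero    i = ≡-mod-refl
  orbit (suc j) i = ≡-mod-trans (eval-cong f (orbit j i)) (step (j ℕ.+ i))

  shift : ∀ j {a b} → c a ≡ c b ⟨mod m ⟩ → c (j ℕ.+ a) ≡ c (j ℕ.+ b) ⟨mod m ⟩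
  shift j {a} {b} ca≡cb = begin
    c (j ℕ.+ a)     ≈⟨ orbit j a ⟨
    iter f j (c a)  ≈⟨ iter-cong f j ca≡cb ⟩
    iter f j (c b)  ≈⟨ orbit j b ⟩
    c (j ℕ.+ b)     ∎

  period : ∀ i → c (i ℕ.+ k) ≡ c i ⟨mod m ⟩
  period i = ≡-mod-trans (shift i closes) (c-≡ (ℕ.+-identityʳ i))

  multiple-period : ∀ q → c (q ℕ.* k) ≡ c 0 ⟨mod m ⟩
  multiple-period zero    = ≡-mod-refl
  multiple-period (suc q) =
    ≡-mod-trans (shift k (multiple-period q)) (≡-mod-trans (c-≡ (ℕ.+-identityʳ k)) closes)

  return : ∀ i → iter f k (c i) ≡ c i ⟨mod m ⟩
  return i = ≡-mod-trans (orbit k i) (≡-mod-trans (c-≡ (ℕ.+-comm k i)) (period i))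

  return-≡ : ∀ {i x} → x ≡ c i ⟨mod m ⟩ → iter f k x ≡ x ⟨mod m ⟩
  return-≡ {i} x≡ci = ≡-mod-trans (iter-cong f k x≡ci) (≡-mod-trans (return i) (≡-mod-sym x≡ci))

  size-divides : ∀ {i x t} → i < k → x ≡ c i ⟨mod m ⟩ → iter f t x ≡ x ⟨mod m ⟩ → k ∣ℕ t
  size-divides {i} {x} {t} i<k x≡ci ftx≡x = m%n≡0⇒n∣m t k (distinct (m%n<n t k) (proj₁ cycle) ct%k≡c0)
    where
    instance _ = ℕ.>-nonZero (proj₁ cycle)
    ct+i≡ci : c (t ℕ.+ i) ≡ c i ⟨mod m ⟩
    ct+i≡ci = begin
      c (t ℕ.+ i)     ≈⟨ orbit t i ⟨
      iter f t (c i)  ≈⟨ iter-cong f t x≡ci ⟨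
      iter f t x      ≈⟨ ftx≡x ⟩
      x               ≈⟨ x≡ci ⟩
      c i             ∎
    k∸i+i≡k : k ℕ.∸ i ℕ.+ i ≡ k
    k∸i+i≡k = ℕ.m∸n+n≡m (ℕ.<⇒≤ i<k)
    t+k≡k∸i+[t+i] : t ℕ.+ k ≡ k ℕ.∸ i ℕ.+ (t ℕ.+ i)
    t+k≡k∸i+[t+i] = sym (trans (cong (λ s → k ℕ.∸ i ℕ.+ s) (ℕ.+-comm t i))
                        (trans (sym (ℕ.+-assoc (k ℕ.∸ i) i t)) (trans (cong (ℕ._+ t) k∸i+i≡k) (ℕ.+-comm k t))))
    ct≡c0 : c t ≡ c 0 ⟨mod m ⟩
    ct≡c0 = begin
      c t                        ≈⟨ period t ⟨
      c (t ℕ.+ k)                ≡⟨ cong c t+k≡k∸i+[t+i] ⟩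
      c (k ℕ.∸ i ℕ.+ (t ℕ.+ i))  ≈⟨ shift (k ℕ.∸ i) ct+i≡ci ⟩
      c (k ℕ.∸ i ℕ.+ i)          ≡⟨ cong c k∸i+i≡k ⟩
      c k                        ≈⟨ closes ⟩
      c 0                        ∎
    ct%k≡c0 : c (t % k) ≡ c 0 ⟨mod m ⟩
    ct%k≡c0 = begin
      c (t % k)                    ≡⟨ cong c (ℕ.+-identityʳ (t % k)) ⟨
      c (t % k ℕ.+ 0)              ≈⟨ shift (t % k) (multiple-period (t / k)) ⟨
      c (t % k ℕ.+ (t / k) ℕ.* k)  ≡⟨ cong c (m≡m%n+[m/n]*n t k) ⟨
      c t                          ≈⟨ ct≡c0 ⟩
      c 0                          ∎

  multiplier-rotate : ∀ i → prodUpTo k (λ j → eval (deriv f) (c (j ℕ.+ i))) ≡ multiplier f k c ⟨mod m ⟩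
  multiplier-rotate zero    = prodUpTo-cong k (λ j _ → eval-cong (deriv f) (c-≡ (ℕ.+-identityʳ j)))
  multiplier-rotate (suc i) = begin
    prodUpTo k (λ j → eval (deriv f) (c (j ℕ.+ suc i)))
      ≈⟨ prodUpTo-cong k (λ j _ → eval-cong (deriv f) (c-≡ (ℕ.+-suc j i))) ⟩
    prodUpTo k (λ j → eval (deriv f) (c (suc j ℕ.+ i)))
      ≈⟨ prodUpTo-rotate k (eval-cong (deriv f) (≡-mod-trans (c-≡ (ℕ.+-comm k i)) (period i))) ⟩
    prodUpTo k (λ j → eval (deriv f) (c (j ℕ.+ i)))
      ≈⟨ multiplier-rotate i ⟩
    multiplier f k c
      ∎

  iterDeriv-≡-multiplier : ∀ {i x} → x ≡ c i ⟨mod m ⟩ → iterDeriv f k x ≡ multiplier f k c ⟨mod m ⟩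
  iterDeriv-≡-multiplier {i} x≡ci = ≡-mod-trans
    (prodUpTo-cong k (λ j _ → eval-cong (deriv f) (≡-mod-trans (iter-cong f j x≡ci) (orbit j i))))
    (multiplier-rotate i)

-- Power sums

sumUpTo : ℕ → (ℕ → ℕ) → ℕ
sumUpTo zero    g = 0
sumUpTo (suc t) g = sumUpTo t g ℕ.+ g t

-- The closed forms of Σ j and Σ j², with both sides moved so that no truncated subtraction occurs.
double-sum-id : ∀ t → 2 ℕ.* sumUpTo t (λ j → j) ℕ.+ t ≡ t ℕ.* t
double-sum-id zero    = refl
double-sum-id (suc t) =
  trans (regroup (sumUpTo t (λ j → j)) t) (trans (cong (ℕ._+ (2 ℕ.* t ℕ.+ 1)) (double-sum-id t)) (square t))
  where
  regroup : ∀ s t → 2 ℕ.* (s ℕ.+ t) ℕ.+ suc t ≡ (2 ℕ.* s ℕ.+ t) ℕ.+ (2 ℕ.* t ℕ.+ 1)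
  regroup = ℕ-Solver.solve-∀
  square : ∀ t → t ℕ.* t ℕ.+ (2 ℕ.* t ℕ.+ 1) ≡ suc t ℕ.* suc t
  square = ℕ-Solver.solve-∀

sextuple-sum-squares : ∀ t → 6 ℕ.* sumUpTo t (λ j → j ℕ.* j) ℕ.+ 3 ℕ.* (t ℕ.* t)
                               ≡ 2 ℕ.* (t ℕ.* t ℕ.* t) ℕ.+ t
sextuple-sum-squares zero    = refl
sextuple-sum-squares (suc t) =
  trans (regroup (sumUpTo t (λ j → j ℕ.* j)) t)
        (trans (cong (ℕ._+ (6 ℕ.* (t ℕ.* t) ℕ.+ 6 ℕ.* t ℕ.+ 3)) (sextuple-sum-squares t)) (cube t))
  where
  regroup : ∀ s t → 6 ℕ.* (s ℕ.+ t ℕ.* t) ℕ.+ 3 ℕ.* (suc t ℕ.* suc t)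
                    ≡ (6 ℕ.* s ℕ.+ 3 ℕ.* (t ℕ.* t)) ℕ.+ (6 ℕ.* (t ℕ.* t) ℕ.+ 6 ℕ.* t ℕ.+ 3)
  regroup = ℕ-Solver.solve-∀
  cube : ∀ t → 2 ℕ.* (t ℕ.* t ℕ.* t) ℕ.+ t ℕ.+ (6 ℕ.* (t ℕ.* t) ℕ.+ 6 ℕ.* t ℕ.+ 3)
               ≡ 2 ℕ.* (suc t ℕ.* suc t ℕ.* suc t) ℕ.+ suc t
  cube = ℕ-Solver.solve-∀

module _ {p : ℕ} (pr : Prime p) where

  ∣-sum-id : 2 < p → p ∣ℕ sumUpTo p (λ j → j)
  ∣-sum-id 2<p with euclidsLemma 2 (sumUpTo p (λ j → j)) pr p∣2s
    where
    p∣2s : p ∣ℕ 2 ℕ.* sumUpTo p (λ j → j)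
    p∣2s = ℕ.∣m+n∣m⇒∣n (subst (p ∣ℕ_) (trans (sym (double-sum-id p)) (ℕ.+-comm _ p)) (ℕ.n∣m*n p))
                       ℕ.∣-refl
  ... | inj₁ p∣2 = contradiction p∣2 (>⇒∤ 2<p)
  ... | inj₂ p∣s = p∣s

  ∣-sum-squares : 3 < p → p ∣ℕ sumUpTo p (λ j → j ℕ.* j)
  ∣-sum-squares 3<p with euclidsLemma 6 (sumUpTo p (λ j → j ℕ.* j)) pr p∣6s
    where
    factor : ∀ p → (2 ℕ.* (p ℕ.* p) ℕ.+ 1) ℕ.* p ≡ 2 ℕ.* (p ℕ.* p ℕ.* p) ℕ.+ p
    factor = ℕ-Solver.solve-∀
    p∣6s : p ∣ℕ 6 ℕ.* sumUpTo p (λ j → j ℕ.* j)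
    p∣6s = ℕ.∣m+n∣m⇒∣n
      (subst (p ∣ℕ_) (trans (factor p) (trans (sym (sextuple-sum-squares p)) (ℕ.+-comm _ (3 ℕ.* (p ℕ.* p)))))
             (ℕ.n∣m*n (2 ℕ.* (p ℕ.* p) ℕ.+ 1)))
      (subst (p ∣ℕ_) (ℕ.*-assoc 3 p p) (ℕ.n∣m*n (3 ℕ.* p)))
  ... | inj₂ p∣s = p∣s
  ... | inj₁ p∣6 with euclidsLemma 2 3 pr p∣6
  ...   | inj₁ p∣2 = contradiction p∣2 (>⇒∤ (ℕ.<-trans (ℕ.n<1+n 2) 3<p))
  ...   | inj₂ p∣3 = contradiction p∣3 (>⇒∤ 3<p)

-- Iterating a map of slope one

module SlopeOneIteration {g : ℤ → ℤ} {x L : ℤ} (E : QuadraticExpansion g x L) {p N : ℕ}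
                         (p∣N : p ∣ℕ N) (L≡1 : L ≡ + 1 ⟨mod p ⟩) (N∣D : + N ∣ g x - x) where

  open QuadraticExpansion E

  private
    D = g x - x
    p∣L-1 = divides-difference L≡1

    pN∣NN : p ℕ.* N ∣ℕ N ℕ.* N
    pN∣NN = ℕ.*-monoˡ-∣ N p∣N

    ppN∣pNN : p ℕ.* (p ℕ.* N) ∣ℕ p ℕ.* N ℕ.* N
    ppN∣pNN = subst (p ℕ.* (p ℕ.* N) ∣ℕ_) (ℕ.*-comm N (p ℕ.* N)) (ℕ.*-monoˡ-∣ (p ℕ.* N) p∣N)

    ppN∣NNN : p ℕ.* (p ℕ.* N) ∣ℕ N ℕ.* N ℕ.* N
    ppN∣NNN = ℕ.∣-trans ppN∣pNN (ℕ.*-monoˡ-∣ N pN∣NN)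

  -- g^t(x) - x modulo p²N: writing g^t(x) = x + e, the step e ↦ D + L e + Q e² + O(e³)
  -- contributes (L - 1) t D and Q t² D² on top of D, as e ≡ t D mod pN.
  approx : ℕ → ℤ
  approx t = + t * D + (L - + 1) * D * + sumUpTo t (λ j → j) + quadratic * (D * D) * + sumUpTo t (λ j → j ℕ.* j)

  approx-suc : ∀ t → approx (suc t) ≡ approx t + D + (L - + 1) * D * + t + quadratic * (D * D) * (+ t * + t)
  approx-suc t =
    trans (cong (λ s → + suc t * D + (L - + 1) * D * (+ T₁ + + t) + quadratic * (D * D) * (+ T₂ + s)) (ℤ.pos-* t t))
          (regroup (+ t) D L quadratic (+ T₁) (+ T₂))
    where
    T₁ = sumUpTo t (λ j → j)
    T₂ = sumUpTo t (λ j → j ℕ.* j)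
    regroup : ∀ t D L Q T₁ T₂ →
      (+ 1 + t) * D + (L - + 1) * D * (T₁ + t) + Q * (D * D) * (T₂ + t * t)
        ≡ t * D + (L - + 1) * D * T₁ + Q * (D * D) * T₂ + D + (L - + 1) * D * t + Q * (D * D) * (t * t)
    regroup = solve-∀

  approx-≡-linear : ∀ t → approx t ≡ + t * D ⟨mod p ℕ.* N ⟩
  approx-≡-linear t = ≡-mod-trans (≡⇒≡-mod (regroup (+ t * D) _ _)) (+-multiple-≡-mod (∣m∣n⇒∣m+n
    (∣m⇒∣m*n (+ sumUpTo t (λ j → j)) (*-pres-∣ p∣L-1 N∣D))
    (∣m⇒∣m*n (+ sumUpTo t (λ j → j ℕ.* j)) (∣n⇒∣m*n quadratic (∣-square p∣N N∣D)))))
    where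
    regroup : ∀ a b c → a + b + c ≡ a + (b + c)
    regroup = solve-∀

  fold-≡-approx : ∀ t → fold x g t ≡ x + approx t ⟨mod p ℕ.* (p ℕ.* N) ⟩
  fold-≡-approx zero    = ≡⇒≡-mod (start x D L quadratic)
    where
    start : ∀ x D L Q → x ≡ x + (+ 0 * D + (L - + 1) * D * + 0 + Q * (D * D) * + 0)
    start = solve-∀
  fold-≡-approx (suc t) = begin
    g y                                                        ≡⟨ cong g (sym (x+[y-x]≡y x y)) ⟩
    g (x + e)                                                  ≡⟨ expand e ⟩
    g x + L * e + quadratic * (e * e) + cubic e * (e * e * e)  ≈⟨ mod-divides (subst (_ ∣_) (sym error) error-divisible) ⟩
    x + approx (suc t)                                         ∎
    where
    open ≡-mod-Reasoning (p ℕ.* (p ℕ.* N))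
    y = fold x g t
    e = y - x
    A = approx t
    x+[y-x]≡y : ∀ x y → x + (y - x) ≡ y
    x+[y-x]≡y = solve-∀
    e-A : + (p ℕ.* (p ℕ.* N)) ∣ e - A
    e-A = subst (_ ∣_) (reassociate y x A) (divides-difference (fold-≡-approx t))
      where
      reassociate : ∀ y x A → y - (x + A) ≡ y - x - A
      reassociate = solve-∀
    e-tD : + (p ℕ.* N) ∣ e - + t * D
    e-tD = subst (_ ∣_) (telescope e A (+ t * D))
             (∣m∣n⇒∣m+n (∣-trans (∣ᵤ⇒∣ (ℕ.n∣m*n p)) e-A) (divides-difference (approx-≡-linear t)))
      where
      telescope : ∀ a b c → (a - b) + (b - c) ≡ a - c
      telescope = solve-∀
    N∣e-tD : + N ∣ e - + t * D
    N∣e-tD = ∣-trans (∣ᵤ⇒∣ (ℕ.n∣m*n p)) e-tD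
    N∣e+tD : + N ∣ e + + t * D
    N∣e+tD = subst (_ ∣_) (twice e (+ t * D)) (∣m∣n⇒∣m+n N∣e-tD (∣n⇒∣m*n (+ 2) (∣n⇒∣m*n (+ t) N∣D)))
      where
      twice : ∀ a b → (a - b) + + 2 * b ≡ a + b
      twice = solve-∀
    N∣e : + N ∣ e
    N∣e = subst (_ ∣_) (cancel e (+ t * D)) (∣m∣n⇒∣m+n N∣e-tD (∣n⇒∣m*n (+ t) N∣D))
      where
      cancel : ∀ a b → (a - b) + b ≡ a
      cancel = solve-∀
    error : g x + L * e + quadratic * (e * e) + cubic e * (e * e * e) - (x + approx (suc t))
              ≡ (e - A) + (L - + 1) * (e - + t * D) + quadratic * ((e - + t * D) * (e + + t * D)) + cubic e * (e * e * e)
    error = trans (cong (λ a → g x + L * e + quadratic * (e * e) + cubic e * (e * e * e) - (x + a)) (approx-suc t))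
                  (expand-error (g x) x e L quadratic (cubic e) A (+ t))
      where
      expand-error : ∀ gx x e L Q R A t → let D = gx - x in
        gx + L * e + Q * (e * e) + R * (e * e * e) - (x + (A + D + (L - + 1) * D * t + Q * (D * D) * (t * t)))
          ≡ (e - A) + (L - + 1) * (e - t * D) + Q * ((e - t * D) * (e + t * D)) + R * (e * e * e)
      expand-error = solve-∀
    error-divisible : + (p ℕ.* (p ℕ.* N)) ∣ (e - A) + (L - + 1) * (e - + t * D)
                        + quadratic * ((e - + t * D) * (e + + t * D)) + cubic e * (e * e * e)
    error-divisible = ∣m∣n⇒∣m+n (∣m∣n⇒∣m+n (∣m∣n⇒∣m+n e-A (*-pres-∣ p∣L-1 e-tD))
      (∣n⇒∣m*n quadratic (∣-trans (∣ᵤ⇒∣ ppN∣pNN) (*-pres-∣ e-tD N∣e+tD))))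
      (∣n⇒∣m*n (cubic e) (∣-trans (∣ᵤ⇒∣ ppN∣NNN) (*-pres-∣ (*-pres-∣ N∣e N∣e) N∣e)))

  fold-p-≡ : p ∣ℕ sumUpTo p (λ j → j) → p ℕ.* (p ℕ.* N) ∣ℕ N ℕ.* N ℕ.* sumUpTo p (λ j → j ℕ.* j) →
             fold x g p ≡ x + + p * D ⟨mod p ℕ.* (p ℕ.* N) ⟩
  fold-p-≡ p∣T₁ ppN∣NNT₂ = ≡-mod-trans (fold-≡-approx p) (+-congˡ-mod x (≡-mod-trans
    (≡⇒≡-mod (regroup (+ p * D) _ _)) (+-multiple-≡-mod (∣m∣n⇒∣m+n linear-term quadratic-term))))
    where
    regroup : ∀ a b c → a + b + c ≡ a + (b + c)
    regroup = solve-∀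
    linear-term : + (p ℕ.* (p ℕ.* N)) ∣ (L - + 1) * D * + sumUpTo p (λ j → j)
    linear-term = ∣-trans (∣ᵤ⇒∣ (ℕ.∣-reflexive (ℕ.*-comm p (p ℕ.* N))))
                          (*-pres-∣ (*-pres-∣ p∣L-1 N∣D) (∣ᵤ⇒∣ p∣T₁))
    quadratic-term : + (p ℕ.* (p ℕ.* N)) ∣ quadratic * (D * D) * + sumUpTo p (λ j → j ℕ.* j)
    quadratic-term = subst (_ ∣_) (sym (ℤ.*-assoc quadratic (D * D) _))
      (∣n⇒∣m*n quadratic (∣-trans (∣ᵤ⇒∣ ppN∣NNT₂) (*-pres-∣ (*-pres-∣ N∣D N∣D) ∣-refl)))

-- The digits r_v

module Residues {p : ℕ} (pr : Prime p) where

  instance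
    p≢0 : NonZero p
    p≢0 = prime⇒nonZero pr

  residue : ℕ → ℤ → ℤ
  residue n a = + (a %ℕ p ^ n)
    where instance _ = ℕ.m^n≢0 p n

  residue-≡ : ∀ n a → residue n a ≡ a ⟨mod p ^ n ⟩
  residue-≡ n a = %ℕ-≡-mod a (p ^ n)
    where instance _ = ℕ.m^n≢0 p n

  rv<p : ∀ n f k a → rv p pr n f k a < p
  rv<p n f k a = n%ℕd<d ((iter f k (residue n a) - residue n a) /ℕ p ^ n) p
    where instance _ = ℕ.m^n≢0 p n

  residue-displacement : ∀ n f k a → iter f k (residue n a) ≡ residue n a ⟨mod p ^ n ⟩ →
            iter f k (residue n a) - residue n a ≡ + rv p pr n f k a * + (p ^ n) ⟨mod p ^ suc n ⟩
  residue-displacement n f k a returns = ∣⇒≡-digit (p ^ n) p (divides-difference returns)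
    where instance _ = ℕ.m^n≢0 p n

module MultiplierOne {p : ℕ} (pr : Prime p) (n : ℕ) (f : Poly) (k : ℕ) (c : ℕ → ℤ)
                     (cycle : IsCycle (p ^ suc n) f k c) (mult : multiplier f k c ≡ + 1 ⟨mod p ⟩) where

  open Residues pr
  open Cycle f c cycle

  private
    N = p ^ suc n

    p∣N : p ∣ℕ N
    p∣N = ℕ.m∣m*n (p ^ n)

    instance
      k≢0 : NonZero k
      k≢0 = ℕ.>-nonZero (proj₁ cycle)
      N≢0 : NonZero N
      N≢0 = ℕ.m^n≢0 p (suc n)
      pN≢0 : NonZero (p ℕ.* N)
      pN≢0 = ℕ.m^n≢0 p (suc (suc n))

  r : ℕ → ℕ
  r i = rv p pr (suc n) f k (c i)

  iterDeriv≡1 : ∀ {i x} → x ≡ c i ⟨mod N ⟩ → iterDeriv f k x ≡ + 1 ⟨mod p ⟩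
  iterDeriv≡1 x≡ci = ≡-mod-trans (≡-mod-weaken p∣N (iterDeriv-≡-multiplier x≡ci)) mult

  displacement : ∀ {i a} → a ≡ c i ⟨mod N ⟩ → iter f k a - a ≡ + r i * + N ⟨mod p ℕ.* N ⟩
  displacement {i} {a} a≡ci = ≡-mod-trans
    (displacement-≡ (iter-expansion f k b) (iterDeriv≡1 b≡ci) p∣N (≡-mod-trans a≡ci (≡-mod-sym b≡ci)))
    (residue-displacement (suc n) f k (c i) (return-≡ b≡ci))
    where
    b = residue (suc n) (c i)
    b≡ci = residue-≡ (suc n) (c i)

  iter-k-≡ : ∀ {i a} → a ≡ c i ⟨mod N ⟩ → iter f k a ≡ a + + r i * + N ⟨mod p ℕ.* N ⟩
  iter-k-≡ {i} {a} a≡ci = -≡⇒≡+-mod {a = iter f k a} {a} (displacement a≡ci)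

  r-suc : ∀ i → + r (suc i) ≡ eval (deriv f) (residue (suc n) (c i)) * + r i ⟨mod p ⟩
  r-suc i = *-cancelʳ-mod N (begin
    + r (suc i) * + N               ≈⟨ displacement fb≡c[1+i] ⟨
    iter f k (eval f b) - eval f b  ≡⟨ cong (_- eval f b) (iter-eval-comm f k b) ⟩
    eval f (iter f k b) - eval f b  ≡⟨ cong (λ z → eval f z - eval f b) (sym (b+[z-b]≡z b (iter f k b))) ⟩
    eval f (b + Δ) - eval f b       ≈⟨ +-congʳ-mod (- eval f b) (linearise (eval-expansion f b) (∣-square p∣N N∣Δ)) ⟩
    eval f b + f′b * Δ - eval f b   ≡⟨ cancel (eval f b) (f′b * Δ) ⟩
    f′b * Δ                         ≈⟨ *-congˡ-mod f′b (displacement b≡ci) ⟩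
    f′b * (+ r i * + N)             ≡⟨ sym (ℤ.*-assoc f′b (+ r i) (+ N)) ⟩
    f′b * + r i * + N               ∎)
    where
    open ≡-mod-Reasoning (p ℕ.* N)
    b = residue (suc n) (c i)
    b≡ci = residue-≡ (suc n) (c i)
    f′b = eval (deriv f) b
    Δ = iter f k b - b
    N∣Δ = divides-difference (return-≡ b≡ci)
    fb≡c[1+i] : eval f b ≡ c (suc i) ⟨mod N ⟩
    fb≡c[1+i] = ≡-mod-trans (eval-cong f b≡ci) (orbit 1 i)
    b+[z-b]≡z : ∀ b z → b + (z - b) ≡ z
    b+[z-b]≡z = solve-∀
    cancel : ∀ a e → a + e - a ≡ e
    cancel = solve-∀

  r-zero-step : ∀ i → r i ≡ 0 → r (suc i) ≡ 0
  r-zero-step i ri≡0 = ≡0-mod⇒≡0 (≡-mod-trans (r-suc i) (≡⇒≡-mod f′b*ri≡0)) (rv<p (suc n) f k (c (suc i)))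
    where
    f′b = eval (deriv f) (residue (suc n) (c i))
    f′b*ri≡0 : f′b * + r i ≡ + 0
    f′b*ri≡0 = trans (cong (λ s → f′b * + s) ri≡0) (ℤ.*-zeroʳ f′b)

  r-nonzero-step : ∀ i → r i ≢ 0 → r (suc i) ≢ 0
  r-nonzero-step i ri≢0 r[1+i]≡0 with prime-∣-* pr p∣f′b*ri
    where
    f′b = eval (deriv f) (residue (suc n) (c i))
    p∣f′b*ri : + p ∣ f′b * + r i
    p∣f′b*ri = subst (+ p ∣_) (ℤ.+-identityʳ (f′b * + r i)) (divides-difference
                 (≡-mod-trans (≡-mod-sym (r-suc i)) (≡⇒≡-mod (cong +_ r[1+i]≡0))))
  ... | inj₁ p∣f′b =
    prime-∤-unit pr (iterDeriv≡1 (residue-≡ (suc n) (c i))) (∣-prodUpTo k (proj₁ cycle) p∣f′b)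
  ... | inj₂ p∣ri  = ri≢0 (∣-<⇒≡0 (∣⇒∣ᵤ p∣ri) (rv<p (suc n) f k (c i)))

  r-uniform : (∀ i → r i ≡ 0) ⊎ (∀ i → r i ≢ 0)
  r-uniform with r 0 ≟ 0
  ... | yes r0≡0 = inj₁ all-zero
    where
    all-zero : ∀ i → r i ≡ 0
    all-zero zero    = r0≡0
    all-zero (suc i) = r-zero-step i (all-zero i)
  ... | no r0≢0 = inj₂ all-nonzero
    where
    all-nonzero : ∀ i → r i ≢ 0
    all-nonzero zero    = r0≢0
    all-nonzero (suc i) = r-nonzero-step i (all-nonzero i)

  module _ (p∣T₁ : p ∣ℕ sumUpTo p (λ j → j))
           (ppN∣NNT₂ : p ℕ.* (p ℕ.* N) ∣ℕ N ℕ.* N ℕ.* sumUpTo p (λ j → j ℕ.* j)) where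

    iter-p*k : ∀ {i x} → x ≡ c i ⟨mod N ⟩ →
               iter f (p ℕ.* k) x ≡ x + + r i * + (p ℕ.* N) ⟨mod p ℕ.* (p ℕ.* N) ⟩
    iter-p*k {i} {x} x≡ci = begin
      iter f (p ℕ.* k) x          ≡⟨ iter-*-fold f k p x ⟩
      fold x (iter f k) p         ≈⟨ fold-p-≡ p∣T₁ ppN∣NNT₂ ⟩
      x + + p * (iter f k x - x)  ≈⟨ +-congˡ-mod x (*-scaleˡ-mod p (displacement x≡ci)) ⟩
      x + + p * (+ r i * + N)     ≡⟨ cong (λ e → x + e) p*[r*N]≡r*pN ⟩
      x + + r i * + (p ℕ.* N)     ∎
      where
      open SlopeOneIteration (iter-expansion f k x) p∣N (iterDeriv≡1 x≡ci) (divides-difference (return-≡ x≡ci))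
      open ≡-mod-Reasoning (p ℕ.* (p ℕ.* N))
      swap : ∀ p r N → p * (r * N) ≡ r * (p * N)
      swap = solve-∀
      p*[r*N]≡r*pN : + p * (+ r i * + N) ≡ + r i * + (p ℕ.* N)
      p*[r*N]≡r*pN = trans (swap (+ p) (+ r i) (+ N)) (cong (+ r i *_) (sym (ℤ.pos-* p N)))

    lifted-size : ∀ {k′ c′ i j} → IsCycle (p ^ suc (suc n)) f k′ c′ → i < k → j < k′ → c′ j ≡ c i ⟨mod N ⟩ →
                  k′ ≡ k ⊎ k′ ≡ p ℕ.* k
    lifted-size {k′} {c′} {i} {j} cycle′ i<k j<k′ c′j≡ci = k∣m∣p*k⇒m≡k⊎m≡p*k pr k∣k′ k′∣pk
      where
      module C′ = Cycle f c′ cycle′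
      k∣k′ : k ∣ℕ k′
      k∣k′ = size-divides i<k c′j≡ci (≡-mod-weaken (ℕ.n∣m*n p) (C′.return j))
      k′∣pk : k′ ∣ℕ p ℕ.* k
      k′∣pk = C′.size-divides j<k′ ≡-mod-refl (≡-mod-trans (≡-mod-weaken (ℕ.n∣m*n p) (iter-p*k c′j≡ci))
                                                           (+-multiple-≡-mod (∣n⇒∣m*n (+ r i) ∣-refl)))

    lifted-r≢0-of-size : ∀ {k′ c′ i j} → IsCycle (p ^ suc (suc n)) f k′ c′ → c′ j ≡ c i ⟨mod N ⟩ →
                k′ ≡ k ⊎ k′ ≡ p ℕ.* k → r i ≢ 0 → rv p pr (suc (suc n)) f k′ (c′ j) ≢ 0
    lifted-r≢0-of-size {c′ = c′} {i} {j} cycle′ c′j≡ci (inj₁ refl) ri≢0 _ =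
      ri≢0 (≡0-mod⇒≡0 (*-cancelʳ-mod N rN≡0) (rv<p (suc n) f k (c i)))
      where
      open ≡-mod-Reasoning (p ℕ.* N)
      rN≡0 : + r i * + N ≡ + 0 ⟨mod p ℕ.* N ⟩
      rN≡0 = begin
        + r i * + N             ≈⟨ displacement c′j≡ci ⟨
        iter f k (c′ j) - c′ j  ≈⟨ +-congʳ-mod (- c′ j) (Cycle.return f c′ cycle′ j) ⟩
        c′ j - c′ j             ≡⟨ ℤ.+-inverseʳ (c′ j) ⟩
        + 0                     ∎
    lifted-r≢0-of-size {c′ = c′} {i} {j} cycle′ c′j≡ci (inj₂ refl) ri≢0 r′≡0 =
      ri≢0 (≡0-mod⇒≡0 (≡-mod-trans (≡-mod-sym r′≡ri) (≡⇒≡-mod (cong +_ r′≡0)))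
                      (rv<p (suc n) f k (c i)))
      where
      open ≡-mod-Reasoning (p ℕ.* (p ℕ.* N))
      b′ = residue (suc (suc n)) (c′ j)
      b′≡c′j = residue-≡ (suc (suc n)) (c′ j)
      b′≡ci : b′ ≡ c i ⟨mod N ⟩
      b′≡ci = ≡-mod-trans (≡-mod-weaken (ℕ.n∣m*n p) b′≡c′j) c′j≡ci
      b′-returns = Cycle.return-≡ f c′ cycle′ b′≡c′j
      r′ = rv p pr (suc (suc n)) f (p ℕ.* k) (c′ j)
      r′≡ri : + r′ ≡ + r i ⟨mod p ⟩
      r′≡ri = *-cancelʳ-mod (p ℕ.* N) (begin
        + r′ * + (p ℕ.* N)        ≈⟨ residue-displacement (suc (suc n)) f (p ℕ.* k) (c′ j) b′-returns ⟨
        iter f (p ℕ.* k) b′ - b′  ≈⟨ ≡+⇒-≡-mod (iter-p*k b′≡ci) ⟩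
        + r i * + (p ℕ.* N)       ∎)

    lifted-r≢0 : ∀ {k′ c′ i j} → IsCycle (p ^ suc (suc n)) f k′ c′ → i < k → j < k′ → c′ j ≡ c i ⟨mod N ⟩ →
                 r i ≢ 0 → rv p pr (suc (suc n)) f k′ (c′ j) ≢ 0
    lifted-r≢0 cycle′ i<k j<k′ c′j≡ci =
      lifted-r≢0-of-size cycle′ c′j≡ci (lifted-size cycle′ i<k j<k′ c′j≡ci)

sum-squares-condition : ∀ {p} n → Prime p → 3 < p ⊎ 1 ≤ n →
  p ℕ.* (p ℕ.* p ^ suc n) ∣ℕ p ^ suc n ℕ.* p ^ suc n ℕ.* sumUpTo p (λ j → j ℕ.* j)
sum-squares-condition {p} n pr (inj₁ 3<p) =
  ℕ.∣-trans (ℕ.∣-reflexive (ℕ.*-comm p (p ℕ.* p ^ suc n)))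
            (ℕ.*-pres-∣ (ℕ.*-monoˡ-∣ (p ^ suc n) (ℕ.m∣m*n {p} (p ^ n))) (∣-sum-squares pr 3<p))
sum-squares-condition {p} (suc n) pr (inj₂ _) =
  ℕ.∣m⇒∣m*n (sumUpTo p (λ j → j ℕ.* j)) (ℕ.∣-trans (ℕ.m∣m*n (p ^ n)) (ℕ.∣-reflexive (regroup p (p ^ n))))
  where
  regroup : ∀ p X → p ℕ.* (p ℕ.* (p ℕ.* (p ℕ.* X))) ℕ.* X ≡ p ℕ.* (p ℕ.* X) ℕ.* (p ℕ.* (p ℕ.* X))
  regroup = ℕ-Solver.solve-∀

lemma4p10 : (p : ℕ) (pr : Prime p) (n : ℕ) → 1 ≤ n → (f : Poly) (k : ℕ) (c : ℕ → ℤ)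
    → IsCycle (p ^ n) f k c
    → multiplier f k c ≡ + 1 [mod p ]
    → ((i : ℕ) → i < k → (a : ℤ) → a ≡ c i [mod p ^ n ]
         → iter f k a ≡ a + (+ rv p pr n f k (c i)) * (+ (p ^ n)) [mod p ^ suc n ])
      × (((i : ℕ) → i < k → rv p pr n f k (c i) ≡ 0)
         ⊎ ((i : ℕ) → i < k → rv p pr n f k (c i) ≢ 0))
      × ((p > 3 ⊎ (p ≡ 3 × n > 1))
         → (k' : ℕ) (c' : ℕ → ℤ) → IsCycle (p ^ suc n) f k' c'
         → ((j : ℕ) → j < k' → Σ ℕ (λ i → i < k × c' j ≡ c i [mod p ^ n ]))
         → (i j : ℕ) → i < k → j < k' → c' j ≡ c i [mod p ^ n ]
         → rv p pr n f k (c i) ≢ 0 → rv p pr (suc n) f k' (c' j) ≢ 0)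
lemma4p10 p pr zero    () f k c cycle mult
lemma4p10 p pr (suc n) _  f k c cycle mult =
    (λ i _ a a≡ci → ⟨mod⟩⇒[mod] (iter-k-≡ {i} {a} ([mod]⇒⟨mod⟩ a≡ci)))
  , Sum.map (λ all i _ → all i) (λ all i _ → all i) r-uniform
  , λ cond k′ c′ cycle′ _ i j i<k j<k′ c′j≡ci →
      lifted-r≢0 (∣-sum-id pr (2<p cond)) (sum-squares-condition n pr (Sum.map₂ 1≤n cond))
                 cycle′ i<k j<k′ ([mod]⇒⟨mod⟩ c′j≡ci)
  where
  open MultiplierOne pr n f k c cycle ([mod]⇒⟨mod⟩ mult)
  2<p : p > 3 ⊎ (p ≡ 3 × suc n > 1) → 2 < p
  2<p (inj₁ 3<p)       = ℕ.<-trans (ℕ.n<1+n 2) 3<p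
  2<p (inj₂ (p≡3 , _)) = subst (2 <_) (sym p≡3) (ℕ.n<1+n 2)
  1≤n : p ≡ 3 × suc n > 1 → 1 ≤ n
  1≤n (_ , ℕ.s≤s 1≤n) = 1≤n
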